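{- Let $m\ge 0$ be an integer and $g=30m+22$. There exists an almost $5$-star factor $F$ on $\{0,1,\dots,30m+21\}$ with $t=4$ isolated vertices such that: (i) every $d\in\{1,2,\dots,15m+10\}$ is the forward difference of at least one edge of $F$; (ii) every $d\in\{1,2,\dots,15m+10\}$ is the forward difference of at most two edges of $F$; (iii) $F$ has no wrap-around edges; (iv) there is a pure/prime labelling of $F$ with respect to which the little star (a star with $3$ edges on the $4$ isolated vertices) is a prime star.
   Context: Let $g\ge 1$ and $t\in\{0,\dots,5\}$ with $g\equiv t\pmod 6$. An almost $5$-star factor on $\{0,1,\dots,g-1\}$ with $t$ isolated vertices is a graph $F$ on this vertex set such that the vertex set is partitioned into $(g-t)/6$ six-element sets, each spanning a connected component of $F$ isomorphic to $K_{1,5}$ (a $5$-star), and one $t$-element set $X$ (the isolated vertices) on which $F$ induces a star $K_{1,t-1}$ (the little star), and $F$ has no other edges. For an edge $\{u,w\}$ with $u<w$, its difference is $\min\{w-u,\,g-(w-u)\}$; the edge is a forward edge if its difference equals $w-u$ (and then $w-u$ is its forward difference), and a wrap-around edge otherwise. A pure/prime labelling of $F$ assigns to each edge of $F$ one of the labels "pure" or "prime" so that no two pure edges have the same difference and no two prime edges have the same difference. With respect to such a labelling, a star is prime if all its edges are prime. -}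

module Defs where

open import Data.Nat using (ℕ; zero; suc; _+_; _*_; _∸_; _≤_; _<_; ∣_-_∣; _⊓_)
open import Data.Nat.Properties using (_≟_)
open import Data.Bool using (Bool; true; false)
open import Data.List using (List; []; _∷_; _++_; map; concatMap; upTo; length)
open import Data.Vec using (Vec; toList)
open import Data.Product using (_×_; _,_; proj₁; proj₂; Σ; ∃)
open import Data.List.Membership.Propositional using (_∈_)
open import Data.List.Relation.Binary.Permutation.Propositional using (_↭_)
open import Data.List.Relation.Unary.All using (All)
open import Relation.Binary.PropositionalEquality using (_≡_; _≢_)
open import Relation.Nullary using (yes; no; ¬_)

-- vertices are natural numbers (the vertex set is {0,...,g-1}, enforced below)
-- an edge is stored as an ordered pair (center , leaf); it denotes the
-- unordered edge {center, leaf}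
Edge : Set
Edge = ℕ × ℕ

record Star (k : ℕ) : Set where
  constructor star
  field
    center : ℕ
    leaves : Vec ℕ k
open Star public

starVerts : ∀ {k} → Star k → List ℕ
starVerts s = center s ∷ toList (leaves s)

starEdges : ∀ {k} → Star k → List Edge
starEdges s = map (λ l → (center s , l)) (toList (leaves s))

-- An almost 5-star factor on {0,...,g-1} with t = k+1 isolated vertices
-- (t ≥ 1): a collection of 5-stars and a little star K_{1,k} whose vertex
-- sets partition {0,...,g-1}.
record AlmostFiveStarFactor (g k : ℕ) : Set where
  constructor factor
  field
    stars  : List (Star 5)
    little : Star k
    partition : (concatMap starVerts stars ++ starVerts little) ↭ upTo g
open AlmostFiveStarFactor public

edgesOf : ∀ {g k} → AlmostFiveStarFactor g k → List Edge
edgesOf F = concatMap starEdges (stars F) ++ starEdges (little F)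

len : Edge → ℕ
len (u , w) = ∣ u - w ∣

difference : ℕ → Edge → ℕ
difference g e = len e ⊓ (g ∸ len e)

Forward : ℕ → Edge → Set
Forward g e = difference g e ≡ len e

HasForwardDiff : ℕ → ℕ → Edge → Set
HasForwardDiff g d e = Forward g e × len e ≡ d

hasForwardDiff? : ℕ → ℕ → Edge → Bool
hasForwardDiff? g d e with difference g e ≟ len e | len e ≟ d
... | yes _ | yes _ = true
... | _     | _     = false

countForwardDiff : ℕ → ℕ → List Edge → ℕ
countForwardDiff g d [] = 0
countForwardDiff g d (e ∷ es) with hasForwardDiff? g d e
... | true  = suc (countForwardDiff g d es)
... | false = countForwardDiff g d es

data Label : Set where
  pure prime : Label

-- a pure/prime labelling of F: a label for each edge (edges of F are
-- distinct as stored pairs, since the vertex sets are disjoint), such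
-- that no two distinct edges with the same label have the same difference
IsPurePrimeLabelling : ∀ {g k} → AlmostFiveStarFactor g k → (Edge → Label) → Set
IsPurePrimeLabelling {g} F lab =
  ∀ e₁ e₂ → e₁ ∈ edgesOf F → e₂ ∈ edgesOf F → e₁ ≢ e₂ →
    lab e₁ ≡ lab e₂ → difference g e₁ ≢ difference g e₂

PrimeStar : ∀ {k} → (Edge → Label) → Star k → Set
PrimeStar lab s = All (λ e → lab e ≡ prime) (starEdges s)

{-# OPTIONS --safe #-}
-- Write g = 6h + 10 (so h = 5m + 2) and split on the parity of h, i.e. on g mod 12.
-- The 5-stars form two staircases (see `staircase`): a staircase with offset γ
-- realises every edge length in (γ, γ + 6k) except those ≡ γ (mod 6), so two
-- staircases with different offsets and the little star cover all differences
-- 1, …, g/2 − 1; the little star also fills the vertices the staircases leave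
-- free. All edges are shorter than g/2, so none wraps around. Labelling one
-- staircase pure and the other edges prime keeps equal lengths in different
-- classes (for g ≡ 4 (mod 12) after moving one clashing edge to the pure class),
-- and any pure/prime labelling bounds the multiplicity of a difference by two:
-- of three edges with the same difference, two would share a label.
module Submission where

open import Defs
open import Data.Nat using (ℕ; zero; suc; _+_; _*_; _≤_; _<_; _≟_; _<?_; z≤n; s≤s; ∣_-_∣)
open import Data.Nat.Properties
open import Data.Nat.DivMod using (_/_; _%_; m%n<n; m≡m%n+[m/n]*n)
open import Data.Nat.Tactic.RingSolver using (solve-∀)
open import Data.Bool using (true; false; if_then_else_)
open import Data.List using (List; []; _∷_; _++_; [_]; map; concatMap; upTo; applyUpTo; iterate; length)
open import Data.List.Properties using (map-++; map-∘; map-id; concatMap-++; ++-assoc; ++-identityʳ)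
open import Data.Vec using () renaming (_∷_ to _∷ᵥ_; map to mapᵥ; iterate to iterateᵥ)
open import Data.Product using (Σ; ∃-syntax; _×_; _,_; proj₁; proj₂)
open import Data.Product.Properties using (≡-dec)
open import Data.Sum using (_⊎_; inj₁; inj₂; [_,_]′)
open import Data.Empty using (⊥-elim)
open import Function using (_∘_; id)
open import Relation.Binary.PropositionalEquality using (_≡_; _≢_; refl; sym; trans; cong; cong₂; subst; subst₂; setoid)
open import Relation.Nullary using (¬_; Dec; yes; no; does; contradiction)
open import Relation.Nullary.Decidable using (_⊎-dec_)
open import Data.List.Membership.Propositional using (_∈_)
open import Data.List.Membership.Propositional.Properties using (∈-++⁺ˡ; ∈-++⁺ʳ; ∈-++⁻; ∈-map⁺; ∈-map⁻)
open import Data.List.Relation.Unary.Any using (here; there)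
open import Data.List.Relation.Unary.All as All using (All; []; _∷_)
open import Data.List.Relation.Unary.All.Properties using () renaming (++⁺ to All-++⁺)
open import Data.List.Relation.Unary.Unique.Propositional using (Unique; []; _∷_)
import Data.List.Relation.Unary.Unique.Propositional.Properties as Unique
open import Data.List.Relation.Binary.Sublist.Propositional using (_⊆_; []; _∷_; _∷ʳ_; ⊆-reflexive; lookup)
open import Data.List.Relation.Binary.Sublist.Propositional.Properties using (All-resp-⊆) renaming (++⁺ to ⊆-++⁺)
open import Data.List.Relation.Binary.Permutation.Propositional
  using (_↭_; ↭-refl; ↭-sym; ↭-trans; ↭-reflexive; ↭-prep; ↭-swap; ↭⇒↭ₛ; module PermutationReasoning)
open import Data.List.Relation.Binary.Permutation.Propositional.Properties
  using (++⁺; ++⁺ˡ; ++⁺ʳ; ++-comm; shift)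
open import Data.List.Relation.Binary.Permutation.Setoid.Properties (setoid ℕ) using (Unique-resp-↭)

range : ℕ → ℕ → List ℕ
range = iterate suc

range-++ : ∀ b m n → range b (m + n) ≡ range b m ++ range (b + m) n
range-++ b zero    n = cong (λ x → range x n) (sym (+-identityʳ b))
range-++ b (suc m) n = cong (b ∷_)
  (trans (range-++ (suc b) m n) (cong (λ x → range (suc b) m ++ range x n) (sym (+-suc b m))))

applyUpTo≡range : ∀ (f : ℕ → ℕ) b n → (∀ x → f x ≡ b + x) → applyUpTo f n ≡ range b n
applyUpTo≡range f b zero    f≗b+ = refl
applyUpTo≡range f b (suc n) f≗b+ = cong₂ _∷_ (trans (f≗b+ 0) (+-identityʳ b))
  (applyUpTo≡range (f ∘ suc) (suc b) n (λ x → trans (f≗b+ (suc x)) (+-suc b x)))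

upTo≡range : ∀ n → upTo n ≡ range 0 n
upTo≡range n = applyUpTo≡range (λ x → x) 0 n (λ _ → refl)

∈-range⁺ : ∀ {x} b n → b ≤ x → x < b + n → x ∈ range b n
∈-range⁺ b zero    b≤x x<b+0 = contradiction (subst (_ <_) (+-identityʳ b) x<b+0) (≤⇒≯ b≤x)
∈-range⁺ {x} b (suc n) b≤x x<b+1+n with b ≟ x
... | yes refl = here refl
... | no  b≢x  = there (∈-range⁺ (suc b) n (≤∧≢⇒< b≤x b≢x) (subst (x <_) (+-suc b n) x<b+1+n))

∈-range⁻ : ∀ {x} b n → x ∈ range b n → b ≤ x × x < b + n
∈-range⁻ b (suc n) (here refl) = ≤-refl , m<m+n b (s≤s z≤n)
∈-range⁻ {x} b (suc n) (there x∈) with ∈-range⁻ (suc b) n x∈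
... | b<x , x<1+b+n = <⇒≤ b<x , subst (x <_) (sym (+-suc b n)) x<1+b+n

-- Leaves are written x + c rather than c + x so that they compute to range (o + c) n.
upStar : (c o n : ℕ) → Star n
upStar c o n = star c (mapᵥ (_+ c) (iterateᵥ suc o n))

upStar-edges : ∀ c o n → starEdges (upStar c o n) ≡ map (λ x → (c , x + c)) (range o n)
upStar-edges c o zero    = refl
upStar-edges c o (suc n) = cong ((c , o + c) ∷_) (upStar-edges c (suc o) n)

∈-upStar⁺ : ∀ c o n {x} → o ≤ x → x < o + n → (c , x + c) ∈ starEdges (upStar c o n)
∈-upStar⁺ c o n o≤x x<o+n =
  subst (_ ∈_) (sym (upStar-edges c o n)) (∈-map⁺ (λ x → (c , x + c)) (∈-range⁺ o n o≤x x<o+n))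

∈-upStar⁻ : ∀ c o n {e} → e ∈ starEdges (upStar c o n) →
            ∃[ x ] (o ≤ x × x < o + n) × e ≡ (c , x + c)
∈-upStar⁻ c o n e∈ with ∈-map⁻ (λ x → (c , x + c)) (subst (_ ∈_) (upStar-edges c o n) e∈)
... | x , x∈ , refl = x , ∈-range⁻ o n x∈ , refl

len-upward : ∀ c x → len (c , x + c) ≡ x
len-upward c x = trans (cong (∣ c -_∣) (+-comm x c)) (∣m-m+n∣≡n c x)

∈-upStar⇒len : ∀ c o n {e} → e ∈ starEdges (upStar c o n) → o ≤ len e × len e < o + n
∈-upStar⇒len c o n e∈ with ∈-upStar⁻ c o n e∈
... | x , bounds , refl = subst (λ l → o ≤ l × l < o + n) (sym (len-upward c x)) bounds

centre-∈-starEdges : ∀ {k e} (s : Star k) → e ∈ starEdges s → proj₁ e ≡ center s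
centre-∈-starEdges s e∈ with ∈-map⁻ (center s ,_) e∈
... | _ , _ , refl = refl

LengthInjective : (Edge → Set) → Set
LengthInjective P = ∀ {e₁ e₂} → P e₁ → P e₂ → len e₁ ≡ len e₂ → e₁ ≡ e₂

LengthInjective-mono : ∀ {P Q : Edge → Set} → (∀ {e} → P e → Q e) → LengthInjective Q → LengthInjective P
LengthInjective-mono P⊆Q injQ p₁ p₂ = injQ (P⊆Q p₁) (P⊆Q p₂)

LengthInjective-⊎ : ∀ {P Q : Edge → Set} → LengthInjective P → LengthInjective Q →
                    (∀ {e₁ e₂} → P e₁ → Q e₂ → len e₁ ≢ len e₂) →
                    LengthInjective (λ e → P e ⊎ Q e)
LengthInjective-⊎ injP injQ sep (inj₁ p₁) (inj₁ p₂) eq = injP p₁ p₂ eq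
LengthInjective-⊎ injP injQ sep (inj₂ q₁) (inj₂ q₂) eq = injQ q₁ q₂ eq
LengthInjective-⊎ injP injQ sep (inj₁ p₁) (inj₂ q₂) eq = contradiction eq (sep p₁ q₂)
LengthInjective-⊎ injP injQ sep (inj₂ q₁) (inj₁ p₂) eq = contradiction (sym eq) (sep p₂ q₁)

LengthInjective-++ : ∀ {xs ys} → LengthInjective (_∈ xs) → LengthInjective (_∈ ys) →
                     (∀ {e₁ e₂} → e₁ ∈ xs → e₂ ∈ ys → len e₁ ≢ len e₂) →
                     LengthInjective (_∈ xs ++ ys)
LengthInjective-++ {xs} injX injY sep =
  LengthInjective-mono (∈-++⁻ xs) (LengthInjective-⊎ injX injY sep)

upStar-lengthInjective : ∀ c o n → LengthInjective (_∈ starEdges (upStar c o n))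
upStar-lengthInjective c o n e₁∈ e₂∈ eq with ∈-upStar⁻ c o n e₁∈ | ∈-upStar⁻ c o n e₂∈
... | x , _ , refl | y , _ , refl =
  cong (λ z → (c , z + c)) (trans (sym (len-upward c x)) (trans eq (len-upward c y)))

short⇒forward : ∀ {g h} e → len e ≤ h → h + h ≤ g → Forward g e
short⇒forward e len≤h h+h≤g = m≤n⇒m⊓n≡m (m+n≤o⇒m≤o∸n (len e) (≤-trans (+-mono-≤ len≤h len≤h) h+h≤g))

All-short⇒forward : ∀ {g h es} → h + h ≤ g → All (λ e → len e ≤ h) es → All (Forward g) es
All-short⇒forward h+h≤g = All.map (λ {e} len≤h → short⇒forward e len≤h h+h≤g)

forward-sameLength : ∀ {g es e₁ e₂} → All (Forward g) es → e₁ ∈ es → e₂ ∈ es →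
                     difference g e₁ ≡ difference g e₂ → len e₁ ≡ len e₂
forward-sameLength forward e₁∈ e₂∈ sameDiff =
  trans (sym (All.lookup forward e₁∈)) (trans sameDiff (All.lookup forward e₂∈))

labelBy : ∀ {P : Edge → Set} → (∀ e → Dec (P e)) → Edge → Label
labelBy P? e = if does (P? e) then pure else prime

module _ {P : Edge → Set} (P? : ∀ e → Dec (P e)) where

  labelBy-isPurePrime : ∀ {g k} (F : AlmostFiveStarFactor g k) → All (Forward g) (edgesOf F) →
                        LengthInjective (λ e → e ∈ edgesOf F × P e) →
                        LengthInjective (λ e → e ∈ edgesOf F × ¬ P e) →
                        IsPurePrimeLabelling F (labelBy P?)
  labelBy-isPurePrime F forward injP inj¬P e₁ e₂ e₁∈ e₂∈ e₁≢e₂ sameLabel sameDiff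
    with P? e₁ | P? e₂ | forward-sameLength forward e₁∈ e₂∈ sameDiff
  ... | yes p₁ | yes p₂ | sameLen = e₁≢e₂ (injP (e₁∈ , p₁) (e₂∈ , p₂) sameLen)
  ... | no ¬p₁ | no ¬p₂ | sameLen = e₁≢e₂ (inj¬P (e₁∈ , ¬p₁) (e₂∈ , ¬p₂) sameLen)
  ... | yes _  | no _   | _ with () ← sameLabel
  ... | no _   | yes _  | _ with () ← sameLabel

  labelBy-primeStar : ∀ {k} (s : Star k) → (∀ {e} → e ∈ starEdges s → ¬ P e) → PrimeStar (labelBy P?) s
  labelBy-primeStar s ¬P = All.tabulate prime-edge
    where
    prime-edge : ∀ {e} → e ∈ starEdges s → labelBy P? e ≡ prime
    prime-edge {e} e∈ with P? e
    ... | yes p = contradiction p (¬P e∈)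
    ... | no _  = refl

Unique-resp-⊇ : ∀ {A : Set} {xs ys : List A} → xs ⊆ ys → Unique ys → Unique xs
Unique-resp-⊇ []           []          = []
Unique-resp-⊇ (_ ∷ʳ xs⊆ys) (_ ∷ uys)   = Unique-resp-⊇ xs⊆ys uys
Unique-resp-⊇ (refl ∷ xs⊆ys) (y∉ ∷ uys) = All-resp-⊆ xs⊆ys y∉ ∷ Unique-resp-⊇ xs⊆ys uys

leaves⊆starVerts : ∀ {k} (s : Star k) → map proj₂ (starEdges s) ⊆ starVerts s
leaves⊆starVerts s = center s ∷ʳ ⊆-reflexive (trans (sym (map-∘ _)) (map-id _))

leaves⊆vertices : ∀ {k} (ss : List (Star 5)) (ℓ : Star k) →
                  map proj₂ (concatMap starEdges ss ++ starEdges ℓ) ⊆ concatMap starVerts ss ++ starVerts ℓ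
leaves⊆vertices []       ℓ = leaves⊆starVerts ℓ
leaves⊆vertices (s ∷ ss) ℓ = subst₂ _⊆_
  (sym (trans (cong (map proj₂) (++-assoc (starEdges s) _ (starEdges ℓ))) (map-++ proj₂ (starEdges s) _)))
  (sym (++-assoc (starVerts s) _ (starVerts ℓ)))
  (⊆-++⁺ (leaves⊆starVerts s) (leaves⊆vertices ss ℓ))

-- An edge is determined by its leaf, and leaves are distinct entries of the
-- duplicate-free vertex list.
edgesOf-unique : ∀ {g k} (F : AlmostFiveStarFactor g k) → Unique (edgesOf F)
edgesOf-unique {g} F = Unique.map⁻ (Unique-resp-⊇ (leaves⊆vertices (stars F) (little F))
  (Unique-resp-↭ (↭⇒↭ₛ (↭-sym (partition F))) (Unique.upTo⁺ g)))

forwardDiffEdges : ℕ → ℕ → List Edge → List Edge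
forwardDiffEdges g d []       = []
forwardDiffEdges g d (e ∷ es) with hasForwardDiff? g d e
... | true  = e ∷ forwardDiffEdges g d es
... | false = forwardDiffEdges g d es

length-forwardDiffEdges : ∀ g d es → length (forwardDiffEdges g d es) ≡ countForwardDiff g d es
length-forwardDiffEdges g d []       = refl
length-forwardDiffEdges g d (e ∷ es) with hasForwardDiff? g d e
... | true  = cong suc (length-forwardDiffEdges g d es)
... | false = length-forwardDiffEdges g d es

forwardDiffEdges⊆ : ∀ g d es → forwardDiffEdges g d es ⊆ es
forwardDiffEdges⊆ g d []       = []
forwardDiffEdges⊆ g d (e ∷ es) with hasForwardDiff? g d e
... | true  = refl ∷ forwardDiffEdges⊆ g d es
... | false = e ∷ʳ forwardDiffEdges⊆ g d es

hasForwardDiff?-sound : ∀ g d e → hasForwardDiff? g d e ≡ true → HasForwardDiff g d e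
hasForwardDiff?-sound g d e _ with difference g e ≟ len e | len e ≟ d
hasForwardDiff?-sound g d e _  | yes forward | yes len≡d = forward , len≡d
hasForwardDiff?-sound g d e () | yes _       | no _
hasForwardDiff?-sound g d e () | no _        | _

forwardDiffEdges-sound : ∀ g d es → All (HasForwardDiff g d) (forwardDiffEdges g d es)
forwardDiffEdges-sound g d []       = []
forwardDiffEdges-sound g d (e ∷ es) with hasForwardDiff? g d e in eq
... | true  = hasForwardDiff?-sound g d e eq ∷ forwardDiffEdges-sound g d es
... | false = forwardDiffEdges-sound g d es

twoAgree : (a b c : Label) → a ≡ b ⊎ a ≡ c ⊎ b ≡ c
twoAgree pure  pure  _     = inj₁ refl
twoAgree prime prime _     = inj₁ refl
twoAgree pure  prime pure  = inj₂ (inj₁ refl)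
twoAgree pure  prime prime = inj₂ (inj₂ refl)
twoAgree prime pure  pure  = inj₂ (inj₂ refl)
twoAgree prime pure  prime = inj₂ (inj₁ refl)

module _ {g k} (F : AlmostFiveStarFactor g k) {lab : Edge → Label} (labelling : IsPurePrimeLabelling F lab) where

  -- Among three distinct edges of equal difference two share a label.
  sameDifference-length≤2 : ∀ {d} fs → Unique fs → All (λ e → e ∈ edgesOf F × difference g e ≡ d) fs →
                            length fs ≤ 2
  sameDifference-length≤2 []          _ _ = z≤n
  sameDifference-length≤2 (_ ∷ [])    _ _ = s≤s z≤n
  sameDifference-length≤2 (_ ∷ _ ∷ []) _ _ = s≤s (s≤s z≤n)
  sameDifference-length≤2 (x ∷ y ∷ z ∷ _) ((x≢y ∷ x≢z ∷ _) ∷ (y≢z ∷ _) ∷ _)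
                          ((x∈ , dx) ∷ (y∈ , dy) ∷ (z∈ , dz) ∷ _)
    with twoAgree (lab x) (lab y) (lab z)
  ... | inj₁ xy        = ⊥-elim (labelling x y x∈ y∈ x≢y xy (trans dx (sym dy)))
  ... | inj₂ (inj₁ xz) = ⊥-elim (labelling x z x∈ z∈ x≢z xz (trans dx (sym dz)))
  ... | inj₂ (inj₂ yz) = ⊥-elim (labelling y z y∈ z∈ y≢z yz (trans dy (sym dz)))

  countForwardDiff≤2 : ∀ d → countForwardDiff g d (edgesOf F) ≤ 2
  countForwardDiff≤2 d = subst (_≤ 2) (length-forwardDiffEdges g d (edgesOf F))
    (sameDifference-length≤2 fs (Unique-resp-⊇ fs⊆ (edgesOf-unique F))
      (All.zipWith (λ (e∈ , (forward , len≡d)) → e∈ , trans forward len≡d)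
        (All.tabulate (lookup fs⊆) , forwardDiffEdges-sound g d (edgesOf F))))
    where
    fs = forwardDiffEdges g d (edgesOf F)
    fs⊆ = forwardDiffEdges⊆ g d (edgesOf F)

-- Star j of `staircase γ b k` has centre b + j and leaves at distances
-- 6i+γ+1, …, 6i+γ+5 for i = k ∸ 1 ∸ j. Its leaf blocks tile an interval, and its
-- edge lengths are the numbers in (γ, γ + 6k) that are not ≡ γ (mod 6).
staircase : (γ b k : ℕ) → List (Star 5)
staircase γ b zero    = []
staircase γ b (suc k) = upStar b (6 * k + γ + 1) 5 ∷ staircase γ (suc b) k

staircaseEdges : (γ b k : ℕ) → List Edge
staircaseEdges γ b k = concatMap starEdges (staircase γ b k)

staircase-vertices : ∀ γ b k → concatMap starVerts (staircase γ b k) ↭ range b k ++ range (b + k + γ) (5 * k)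
staircase-vertices γ b zero    = ↭-refl
staircase-vertices γ b (suc k) = ↭-prep b (begin
    range (6 * k + γ + 1 + b) 5 ++ concatMap starVerts (staircase γ (suc b) k)
  ↭⟨ ++-comm (range (6 * k + γ + 1 + b) 5) _ ⟩
    concatMap starVerts (staircase γ (suc b) k) ++ range (6 * k + γ + 1 + b) 5
  ↭⟨ ++⁺ʳ _ (staircase-vertices γ (suc b) k) ⟩
    (range (suc b) k ++ range (suc b + k + γ) (5 * k)) ++ range (6 * k + γ + 1 + b) 5
  ≡⟨ ++-assoc (range (suc b) k) _ _ ⟩
    range (suc b) k ++ (range (suc b + k + γ) (5 * k) ++ range (6 * k + γ + 1 + b) 5)
  ≡⟨ cong (range (suc b) k ++_) (trans (cong₂ (λ x y → range x (5 * k) ++ range y 5) leafStart leafEnd)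
                                       (sym (range-++ (b + suc k + γ) (5 * k) 5))) ⟩
    range (suc b) k ++ range (b + suc k + γ) (5 * k + 5)
  ≡⟨ cong (λ n → range (suc b) k ++ range (b + suc k + γ) n) (trans (+-comm (5 * k) 5) (sym (*-suc 5 k))) ⟩
    range (suc b) k ++ range (b + suc k + γ) (5 * suc k)
  ∎)
  where
  open PermutationReasoning
  leafStart : suc b + k + γ ≡ b + suc k + γ
  leafStart = cong (_+ γ) (sym (+-suc b k))
  leafEnd : 6 * k + γ + 1 + b ≡ b + suc k + γ + 5 * k
  leafEnd = arith b k γ
    where arith : ∀ b k γ → 6 * k + γ + 1 + b ≡ b + suc k + γ + 5 * k
          arith = solve-∀

staircase-vertices-gap : ∀ γ b k → concatMap starVerts (staircase γ b k) ++ range (b + k) γ ↭ range b (6 * k + γ)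
staircase-vertices-gap γ b k = begin
    concatMap starVerts (staircase γ b k) ++ range (b + k) γ
  ↭⟨ ++⁺ʳ _ (staircase-vertices γ b k) ⟩
    (range b k ++ range (b + k + γ) (5 * k)) ++ range (b + k) γ
  ≡⟨ ++-assoc (range b k) _ _ ⟩
    range b k ++ (range (b + k + γ) (5 * k) ++ range (b + k) γ)
  ↭⟨ ++⁺ˡ (range b k) (++-comm (range (b + k + γ) (5 * k)) _) ⟩
    range b k ++ (range (b + k) γ ++ range (b + k + γ) (5 * k))
  ≡⟨ sym (trans (range-++ b k (γ + 5 * k)) (cong (range b k ++_) (range-++ (b + k) γ (5 * k)))) ⟩
    range b (k + (γ + 5 * k))
  ≡⟨ cong (range b) (arith k γ) ⟩
    range b (6 * k + γ)
  ∎
  where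
  open PermutationReasoning
  arith : ∀ k γ → k + (γ + 5 * k) ≡ 6 * k + γ
  arith = solve-∀

staircase-centre : ∀ γ b k {e} → e ∈ staircaseEdges γ b k → b ≤ proj₁ e × proj₁ e < b + k
staircase-centre γ b (suc k) e∈ with ∈-++⁻ (starEdges (upStar b (6 * k + γ + 1) 5)) e∈
... | inj₁ e∈head rewrite centre-∈-starEdges (upStar b (6 * k + γ + 1) 5) e∈head =
  ≤-refl , m<m+n b (s≤s z≤n)
... | inj₂ e∈tail with staircase-centre γ (suc b) k e∈tail
...   | b<c , c<1+b+k = <⇒≤ b<c , <-≤-trans c<1+b+k (≤-reflexive (sym (+-suc b k)))

staircase-length : ∀ γ b k {e} → e ∈ staircaseEdges γ b k → γ < len e × len e < 6 * k + γ
staircase-length γ b (suc k) e∈ with ∈-++⁻ (starEdges (upStar b (6 * k + γ + 1) 5)) e∈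
... | inj₁ e∈head =
  let o≤len , len<o+5 = ∈-upStar⇒len b (6 * k + γ + 1) 5 e∈head
  in <-≤-trans (≤-<-trans (m≤n+m γ (6 * k)) (m<m+n (6 * k + γ) (s≤s z≤n))) o≤len ,
     <-≤-trans len<o+5 (≤-reflexive (arith k γ))
  where arith : ∀ k γ → 6 * k + γ + 1 + 5 ≡ 6 * suc k + γ
        arith = solve-∀
... | inj₂ e∈tail with staircase-length γ (suc b) k e∈tail
...   | γ<len , len<6k+γ = γ<len , <-≤-trans len<6k+γ (+-monoˡ-≤ γ (*-monoʳ-≤ 6 (n≤1+n k)))

staircase-lengthInjective : ∀ γ b k → LengthInjective (_∈ staircaseEdges γ b k)
staircase-lengthInjective γ b zero    ()
staircase-lengthInjective γ b (suc k) =
  LengthInjective-++ (upStar-lengthInjective b (6 * k + γ + 1) 5) (staircase-lengthInjective γ (suc b) k)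
    (λ e₁∈head e₂∈tail eq → <⇒≱ (proj₂ (staircase-length γ (suc b) k e₂∈tail))
       (≤-trans (m≤m+n (6 * k + γ) 1)
          (≤-trans (proj₁ (∈-upStar⇒len b (6 * k + γ + 1) 5 e₁∈head)) (≤-reflexive eq))))

staircase-covers : ∀ γ b {k i r} → i < k → r < 5 →
                   ∃[ e ] e ∈ staircaseEdges γ b k × len e ≡ 6 * i + γ + 1 + r
staircase-covers γ b {suc k} {i} {r} i<1+k r<5 with m<1+n⇒m<n∨m≡n i<1+k
... | inj₁ i<k with staircase-covers γ (suc b) i<k r<5
...   | e , e∈ , len≡ = e , ∈-++⁺ʳ _ e∈ , len≡
staircase-covers γ b {suc k} {i} {r} i<1+k r<5 | inj₂ refl =
  (b , (6 * i + γ + 1 + r) + b) ,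
  ∈-++⁺ˡ (∈-upStar⁺ b (6 * i + γ + 1) 5 (m≤m+n _ r) (+-monoʳ-< _ r<5)) ,
  len-upward b _

CoveringFactor : ℕ → ℕ → Set
CoveringFactor g n = Σ (AlmostFiveStarFactor g 3) λ F →
  ((d : ℕ) → 1 ≤ d → d ≤ n → Σ Edge λ e → e ∈ edgesOf F × HasForwardDiff g d e)
  × ((d : ℕ) → 1 ≤ d → d ≤ n → countForwardDiff g d (edgesOf F) ≤ 2)
  × All (Forward g) (edgesOf F)
  × Σ (Edge → Label) λ lab → IsPurePrimeLabelling F lab × PrimeStar lab (little F)

coveringFactor-criterion : ∀ {g n} (F : AlmostFiveStarFactor g 3) {lab : Edge → Label} →
  All (Forward g) (edgesOf F) →
  ((d : ℕ) → 1 ≤ d → d ≤ n → ∃[ e ] e ∈ edgesOf F × len e ≡ d) →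
  IsPurePrimeLabelling F lab → PrimeStar lab (little F) → CoveringFactor g n
coveringFactor-criterion F {lab} forward covers labelling primeLittle =
  F , covers′ , (λ d _ _ → countForwardDiff≤2 F labelling d) , forward , lab , labelling , primeLittle
  where
  covers′ = λ d 1≤d d≤n → let e , e∈ , len≡d = covers d 1≤d d≤n in e , e∈ , All.lookup forward e∈ , len≡d

adjacent-ranges : ∀ {xs ys : List ℕ} {b m n} → xs ↭ range b m → ys ↭ range (b + m) n → xs ++ ys ↭ range b (m + n)
adjacent-ranges {b = b} {m} {n} xs↭ ys↭ = ↭-trans (++⁺ xs↭ ys↭) (↭-reflexive (sym (range-++ b m n)))

module Parts {g k} (A B : List (Star 5)) (L : Star k) (p : concatMap starVerts (A ++ B) ++ starVerts L ↭ upTo g) where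

  F : AlmostFiveStarFactor g k
  F = factor (A ++ B) L p

  EA EB EL : List Edge
  EA = concatMap starEdges A
  EB = concatMap starEdges B
  EL = starEdges L

  edgesOf≡ : edgesOf F ≡ (EA ++ EB) ++ EL
  edgesOf≡ = cong (_++ EL) (concatMap-++ starEdges A B)

  ∈-edgesOf⁻ : ∀ {e} → e ∈ edgesOf F → e ∈ EA ⊎ e ∈ EB ⊎ e ∈ EL
  ∈-edgesOf⁻ e∈ with ∈-++⁻ (EA ++ EB) (subst (_ ∈_) edgesOf≡ e∈)
  ... | inj₂ e∈L = inj₂ (inj₂ e∈L)
  ... | inj₁ e∈AB with ∈-++⁻ EA e∈AB
  ...   | inj₁ e∈A = inj₁ e∈A
  ...   | inj₂ e∈B = inj₂ (inj₁ e∈B)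

  ∈-edgesOf⁺ : ∀ {e} → e ∈ EA ⊎ e ∈ EB ⊎ e ∈ EL → e ∈ edgesOf F
  ∈-edgesOf⁺ e∈ = subst (_ ∈_) (sym edgesOf≡) (case e∈)
    where
    case : ∀ {e} → e ∈ EA ⊎ e ∈ EB ⊎ e ∈ EL → e ∈ (EA ++ EB) ++ EL
    case (inj₁ e∈A)        = ∈-++⁺ˡ (∈-++⁺ˡ e∈A)
    case (inj₂ (inj₁ e∈B)) = ∈-++⁺ˡ (∈-++⁺ʳ EA e∈B)
    case (inj₂ (inj₂ e∈L)) = ∈-++⁺ʳ (EA ++ EB) e∈L

  All-edgesOf⁺ : ∀ {P : Edge → Set} → All P EA → All P EB → All P EL → All P (edgesOf F)
  All-edgesOf⁺ allA allB allL = subst (All _) (sym edgesOf≡) (All-++⁺ (All-++⁺ allA allB) allL)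

divMod6 : ∀ x → ∃[ q ] ∃[ r ] r < 6 × x ≡ r + q * 6
divMod6 x = x / 6 , x % 6 , m%n<n x 6 , m≡m%n+[m/n]*n x 6

quotient-< : ∀ {s q n} → s + q * 6 < n * 6 → q < n
quotient-< {s} {q} {n} lt = *-cancelʳ-< 6 q n (≤-<-trans (m≤n+m (q * 6) s) lt)

-- A covers the lengths ≢ 0 (mod 6) and B the multiples of 6.
module Mod12≡10 (k : ℕ) where

  T = 6 * suc k
  A = staircase 0 0 (suc k)
  B = staircase 4 T k
  L = upStar (T + k) 1 3

  vertices : concatMap starVerts (A ++ B) ++ starVerts L ↭ upTo (12 * k + 10)
  vertices = begin
      concatMap starVerts (A ++ B) ++ starVerts L
    ≡⟨ trans (cong (_++ starVerts L) (concatMap-++ starVerts A B)) (++-assoc (concatMap starVerts A) _ _) ⟩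
      concatMap starVerts A ++ (concatMap starVerts B ++ range (T + k) 4)
    ↭⟨ adjacent-ranges verticesA (staircase-vertices-gap 4 T k) ⟩
      range 0 (T + (6 * k + 4))
    ≡⟨ trans (cong (range 0) (arith k)) (sym (upTo≡range _)) ⟩
      upTo (12 * k + 10)
    ∎
    where
    open PermutationReasoning
    verticesA : concatMap starVerts A ↭ range 0 T
    verticesA = ↭-trans (↭-reflexive (sym (++-identityʳ _)))
                  (↭-trans (staircase-vertices-gap 0 0 (suc k)) (↭-reflexive (cong (range 0) (+-identityʳ T))))
    arith : ∀ k → 6 * suc k + (6 * k + 4) ≡ 12 * k + 10
    arith = solve-∀

  open Parts A B L vertices public

  forward : All (Forward (12 * k + 10)) (edgesOf F)
  forward = All-short⇒forward (≤-reflexive (arith k))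
    (All-edgesOf⁺ (All.tabulate (λ e∈ → ≤-pred (<-≤-trans (proj₂ (staircase-length 0 0 (suc k) e∈))
                                                            (≤-reflexive (arithA k)))))
                  (All.tabulate (λ e∈ → ≤-trans (<⇒≤ (proj₂ (staircase-length 4 T k e∈)))
                                                (+-monoʳ-≤ (6 * k) (n≤1+n 4))))
                  (All.tabulate (λ e∈ → ≤-trans (<⇒≤ (proj₂ (∈-upStar⇒len (T + k) 1 3 e∈)))
                                                (≤-trans (n≤1+n 4) (m≤n+m 5 (6 * k))))))
    where
    arith : ∀ k → (6 * k + 5) + (6 * k + 5) ≡ 12 * k + 10
    arith = solve-∀
    arithA : ∀ k → 6 * suc k + 0 ≡ suc (6 * k + 5)
    arithA = solve-∀

  T≤centre : ∀ {e} → e ∈ EB ⊎ e ∈ EL → T ≤ proj₁ e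
  T≤centre (inj₁ e∈B) = proj₁ (staircase-centre 4 T k e∈B)
  T≤centre (inj₂ e∈L) = subst (T ≤_) (sym (centre-∈-starEdges L e∈L)) (m≤m+n T k)

  pure? : (e : Edge) → Dec (proj₁ e < T)
  pure? e = proj₁ e <? T

  pureEdges⊆A : ∀ {e} → e ∈ edgesOf F × proj₁ e < T → e ∈ EA
  pureEdges⊆A (e∈ , c<T) = [ id , (λ e∈BL → contradiction (T≤centre e∈BL) (<⇒≱ c<T)) ]′ (∈-edgesOf⁻ e∈)

  primeEdges⊆BL : ∀ {e} → e ∈ edgesOf F × ¬ proj₁ e < T → e ∈ EB ⊎ e ∈ EL
  primeEdges⊆BL (e∈ , ¬c<T) = [ (λ e∈A → contradiction (centreA e∈A) ¬c<T) , id ]′ (∈-edgesOf⁻ e∈)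
    where centreA = λ e∈A → <-≤-trans (proj₂ (staircase-centre 0 0 (suc k) e∈A)) (m≤n*m (suc k) 6)

  prime-lengthInjective : LengthInjective (λ e → e ∈ EB ⊎ e ∈ EL)
  prime-lengthInjective = LengthInjective-⊎ (staircase-lengthInjective 4 T k) (upStar-lengthInjective (T + k) 1 3)
    (λ e₁∈B e₂∈L eq → <⇒≱ (proj₂ (∈-upStar⇒len (T + k) 1 3 e₂∈L))
                           (≤-trans (<⇒≤ (proj₁ (staircase-length 4 T k e₁∈B))) (≤-reflexive eq)))

  labelling : IsPurePrimeLabelling F (labelBy pure?)
  labelling = labelBy-isPurePrime pure? F forward
    (LengthInjective-mono pureEdges⊆A (staircase-lengthInjective 0 0 (suc k)))
    (LengthInjective-mono primeEdges⊆BL prime-lengthInjective)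

  primeLittle : PrimeStar (labelBy pure?) L
  primeLittle = labelBy-primeStar pure? L (λ e∈L c<T → <⇒≱ c<T (T≤centre (inj₂ e∈L)))

  6k+4<6[k+1] : 6 * k + 4 < suc k * 6
  6k+4<6[k+1] = <-≤-trans (+-monoʳ-< (6 * k) (n≤1+n 5)) (≤-reflexive (arith k))
    where arith : ∀ k → 6 * k + 6 ≡ suc k * 6
          arith = solve-∀

  covers : (d : ℕ) → 1 ≤ d → d ≤ 6 * k + 4 → ∃[ e ] e ∈ edgesOf F × len e ≡ d
  covers (suc x) _ d≤ with divMod6 x
  ... | q , r , r<6 , refl with m<1+n⇒m<n∨m≡n r<6
  ...   | inj₁ r<5 =
    let e , e∈ , len≡ = staircase-covers 0 0 {suc k} {q} {r} (quotient-< (<-trans d≤ 6k+4<6[k+1])) r<5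
    in e , ∈-edgesOf⁺ (inj₁ e∈) , trans len≡ (arith q r)
    where arith : ∀ q r → 6 * q + 0 + 1 + r ≡ suc (r + q * 6)
          arith = solve-∀
  ...   | inj₂ refl =
    let e , e∈ , len≡ = staircase-covers 4 T {k} {q} {1}
                          (≤-pred (quotient-< {0} (≤-<-trans d≤ 6k+4<6[k+1]))) (s≤s (s≤s z≤n))
    in e , ∈-edgesOf⁺ (inj₂ (inj₁ e∈)) , trans len≡ (arith q)
    where arith : ∀ q → 6 * q + 4 + 1 + 1 ≡ suc (5 + q * 6)
          arith = solve-∀

coveringFactor-12k+10 : ∀ k → CoveringFactor (12 * k + 10) (6 * k + 4)
coveringFactor-12k+10 k = coveringFactor-criterion F forward covers labelling primeLittle
  where open Mod12≡10 k

++-transfer-↭ : ∀ {A : Set} (xs ys : List A) c x zs → (xs ++ ys) ++ (c ∷ x ∷ zs) ↭ (xs ++ [ x ]) ++ (ys ++ c ∷ zs)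
++-transfer-↭ xs ys c x zs = begin
    (xs ++ ys) ++ (c ∷ x ∷ zs)   ↭⟨ ++⁺ˡ (xs ++ ys) (↭-swap c x ↭-refl) ⟩
    (xs ++ ys) ++ (x ∷ c ∷ zs)   ≡⟨ ++-assoc xs ys _ ⟩
    xs ++ (ys ++ (x ∷ c ∷ zs))   ↭⟨ ++⁺ˡ xs (shift x ys (c ∷ zs)) ⟩
    xs ++ (x ∷ ys ++ c ∷ zs)     ≡⟨ sym (++-assoc xs [ x ] _) ⟩
    (xs ++ [ x ]) ++ (ys ++ c ∷ zs) ∎
  where open PermutationReasoning

-- A covers the lengths ≢ 1 (mod 6) from 2 on and B those ≡ 1 from 7 on; the
-- little star, whose leaf K fills the gap left in A, covers 1.
module Mod12≡4 (q : ℕ) where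

  K = suc q
  TB = 6 * K + 1
  C = TB + K
  A = staircase 1 0 K
  B = staircase 3 TB K
  L : Star 3
  L = star C (K ∷ᵥ leaves (upStar C 1 2))

  vertices : concatMap starVerts (A ++ B) ++ starVerts L ↭ upTo (12 * K + 4)
  vertices = begin
      concatMap starVerts (A ++ B) ++ (C ∷ K ∷ range (suc C) 2)
    ≡⟨ cong (_++ starVerts L) (concatMap-++ starVerts A B) ⟩
      (concatMap starVerts A ++ concatMap starVerts B) ++ (C ∷ K ∷ range (suc C) 2)
    ↭⟨ ++-transfer-↭ (concatMap starVerts A) _ C K _ ⟩
      (concatMap starVerts A ++ range K 1) ++ (concatMap starVerts B ++ range C 3)
    ↭⟨ adjacent-ranges (staircase-vertices-gap 1 0 K) (staircase-vertices-gap 3 TB K) ⟩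
      range 0 (TB + (6 * K + 3))
    ≡⟨ trans (cong (range 0) (arith K)) (sym (upTo≡range _)) ⟩
      upTo (12 * K + 4)
    ∎
    where
    open PermutationReasoning
    arith : ∀ K → 6 * K + 1 + (6 * K + 3) ≡ 12 * K + 4
    arith = solve-∀

  open Parts A B L vertices public

  clashEdge : ∃[ e ] e ∈ EB × len e ≡ 6 * q + 3 + 1 + 3
  clashEdge = staircase-covers 3 TB (n<1+n q) (s≤s (s≤s (s≤s (s≤s z≤n))))

  clash : Edge
  clash = proj₁ clashEdge

  clash∈B : clash ∈ EB
  clash∈B = proj₁ (proj₂ clashEdge)

  len-clash : len clash ≡ TB
  len-clash = trans (proj₂ (proj₂ clashEdge)) (arith q)
    where arith : ∀ q → 6 * q + 3 + 1 + 3 ≡ 6 * suc q + 1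
          arith = solve-∀

  len-CK : len (C , K) ≡ TB
  len-CK = trans (∣-∣-comm C K) (trans (cong (∣ K -_∣) (+-comm TB K)) (∣m-m+n∣≡n K TB))

  forward : All (Forward (12 * K + 4)) (edgesOf F)
  forward = All-short⇒forward (≤-reflexive (arith K))
    (All-edgesOf⁺ (All.tabulate (λ e∈ → ≤-trans (<⇒≤ (proj₂ (staircase-length 1 0 K e∈))) TB≤h))
                  (All.tabulate (λ e∈ → ≤-pred (<-≤-trans (proj₂ (staircase-length 3 TB K e∈))
                                                          (≤-reflexive (arithB K)))))
                  (≤-trans (≤-reflexive len-CK) TB≤h
                   ∷ All.tabulate (λ e∈ → ≤-trans (≤-pred (proj₂ (∈-upStar⇒len C 1 2 e∈))) (m≤n+m 2 (6 * K)))))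
    where
    TB≤h : TB ≤ 6 * K + 2
    TB≤h = +-monoʳ-≤ (6 * K) (n≤1+n 1)
    arith : ∀ K → (6 * K + 2) + (6 * K + 2) ≡ 12 * K + 4
    arith = solve-∀
    arithB : ∀ K → 6 * K + 3 ≡ suc (6 * K + 2)
    arithB = solve-∀

  K≤centre : ∀ {e} → e ∈ EB ⊎ e ∈ EL → K ≤ proj₁ e
  K≤centre (inj₁ e∈B) = ≤-trans (≤-trans (m≤n*m K 6) (m≤m+n (6 * K) 1)) (proj₁ (staircase-centre 3 TB K e∈B))
  K≤centre (inj₂ e∈L) = subst (K ≤_) (sym (centre-∈-starEdges L e∈L)) (m≤n+m K TB)

  -- The only length shared by B and the little star is 6K+1 = len (C , K),
  -- so the B-edge `clash` of that length joins the pure edges.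
  Pure : Edge → Set
  Pure e = proj₁ e < K ⊎ e ≡ clash

  pure? : (e : Edge) → Dec (Pure e)
  pure? e = (proj₁ e <? K) ⊎-dec (≡-dec _≟_ _≟_ e clash)

  pureEdges⊆A∪clash : ∀ {e} → e ∈ edgesOf F × Pure e → e ∈ EA ⊎ e ≡ clash
  pureEdges⊆A∪clash (_  , inj₂ e≡clash) = inj₂ e≡clash
  pureEdges⊆A∪clash (e∈ , inj₁ c<K) =
    [ inj₁ , (λ e∈BL → contradiction (K≤centre e∈BL) (<⇒≱ c<K)) ]′ (∈-edgesOf⁻ e∈)

  primeEdges⊆B∪L : ∀ {e} → e ∈ edgesOf F × ¬ Pure e → (e ∈ EB × e ≢ clash) ⊎ e ∈ EL
  primeEdges⊆B∪L {e} (e∈ , ¬pure) = classify (∈-edgesOf⁻ e∈)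
    where
    classify : e ∈ EA ⊎ e ∈ EB ⊎ e ∈ EL → (e ∈ EB × e ≢ clash) ⊎ e ∈ EL
    classify (inj₁ e∈A)        = contradiction (inj₁ (proj₂ (staircase-centre 1 0 K e∈A))) ¬pure
    classify (inj₂ (inj₁ e∈B)) = inj₁ (e∈B , ¬pure ∘ inj₂)
    classify (inj₂ (inj₂ e∈L)) = inj₂ e∈L

  little-lengthInjective : LengthInjective (_∈ EL)
  little-lengthInjective = LengthInjective-++ {[ (C , K) ]} (λ { (here refl) (here refl) _ → refl })
    (upStar-lengthInjective C 1 2)
    (λ { (here refl) e₂∈ eq → <⇒≱ (proj₂ (∈-upStar⇒len C 1 2 e₂∈))
                                   (≤-trans (m≤n+m 3 (6 * q + 4)) (≤-reflexive (trans (arith q) (trans (sym len-CK) eq)))) })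
    where arith : ∀ q → 6 * q + 4 + 3 ≡ 6 * suc q + 1
          arith = solve-∀

  pure-lengthInjective : LengthInjective (λ e → e ∈ EA ⊎ e ≡ clash)
  pure-lengthInjective = LengthInjective-⊎ (staircase-lengthInjective 1 0 K) (λ { refl refl _ → refl })
    (λ e₁∈A e₂≡clash eq → <⇒≢ (proj₂ (staircase-length 1 0 K e₁∈A))
                               (trans eq (trans (cong len e₂≡clash) len-clash)))

  prime-lengthInjective : LengthInjective (λ e → (e ∈ EB × e ≢ clash) ⊎ e ∈ EL)
  prime-lengthInjective =
    LengthInjective-⊎ (LengthInjective-mono proj₁ (staircase-lengthInjective 3 TB K)) little-lengthInjective
      λ { (e₁∈B , e₁≢clash) (here refl) eq →
            e₁≢clash (staircase-lengthInjective 3 TB K e₁∈B clash∈B (trans eq (trans len-CK (sym len-clash))))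
        ; (e₁∈B , _) (there e₂∈) eq → <⇒≱ (proj₂ (∈-upStar⇒len C 1 2 e₂∈))
                                          (≤-trans (<⇒≤ (proj₁ (staircase-length 3 TB K e₁∈B))) (≤-reflexive eq)) }

  labelling : IsPurePrimeLabelling F (labelBy pure?)
  labelling = labelBy-isPurePrime pure? F forward
    (LengthInjective-mono pureEdges⊆A∪clash pure-lengthInjective)
    (LengthInjective-mono primeEdges⊆B∪L prime-lengthInjective)

  primeLittle : PrimeStar (labelBy pure?) L
  primeLittle = labelBy-primeStar pure? L ¬pure
    where
    ¬pure : ∀ {e} → e ∈ EL → ¬ Pure e
    ¬pure e∈L (inj₁ c<K) = <⇒≱ c<K (K≤centre (inj₂ e∈L))
    ¬pure e∈L (inj₂ refl) = <-irrefl (centre-∈-starEdges L e∈L) (proj₂ (staircase-centre 3 TB K clash∈B))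

  x<K*6 : ∀ {x} → suc (suc x) ≤ 6 * K + 1 → x < K * 6
  x<K*6 d≤ = ≤-pred (≤-trans d≤ (≤-reflexive (trans (+-comm (6 * K) 1) (cong suc (*-comm 6 K)))))

  covers : (d : ℕ) → 1 ≤ d → d ≤ 6 * K + 1 → ∃[ e ] e ∈ edgesOf F × len e ≡ d
  covers 1 _ _ = (C , 1 + C) , ∈-edgesOf⁺ (inj₂ (inj₂ (there (here refl)))) , len-upward C 1
  covers (suc (suc x)) _ d≤ with divMod6 x
  ... | q′ , r , r<6 , refl with m<1+n⇒m<n∨m≡n r<6
  ...   | inj₁ r<5 =
    let e , e∈ , len≡ = staircase-covers 1 0 {K} {q′} {r} (quotient-< (x<K*6 d≤)) r<5
    in e , ∈-edgesOf⁺ (inj₁ e∈) , trans len≡ (arith q′ r)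
    where arith : ∀ q r → 6 * q + 1 + 1 + r ≡ suc (suc (r + q * 6))
          arith = solve-∀
  ...   | inj₂ refl =
    let e , e∈ , len≡ = staircase-covers 3 TB {K} {q′} {3} (quotient-< (x<K*6 d≤)) (s≤s (s≤s (s≤s (s≤s z≤n))))
    in e , ∈-edgesOf⁺ (inj₂ (inj₁ e∈)) , trans len≡ (arith q′)
    where arith : ∀ q → 6 * q + 3 + 1 + 3 ≡ suc (suc (5 + q * 6))
          arith = solve-∀

coveringFactor-12[k+1]+4 : ∀ k → CoveringFactor (12 * suc k + 4) (6 * suc k + 1)
coveringFactor-12[k+1]+4 k = coveringFactor-criterion F forward covers labelling primeLittle
  where open Mod12≡4 k

parity : ∀ h → ∃[ k ] (h ≡ k + k ⊎ h ≡ suc (k + k))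
parity zero    = 0 , inj₁ refl
parity (suc h) with parity h
... | k , inj₁ refl = k , inj₂ refl
... | k , inj₂ refl = suc k , inj₁ (cong suc (sym (+-suc k k)))

coveringFactor : ∀ h → CoveringFactor (6 * h + 10) (3 * h + 4)
coveringFactor h with parity h
... | k , inj₁ refl = subst₂ CoveringFactor (arith₁ k) (arith₂ k) (coveringFactor-12k+10 k)
  where arith₁ : ∀ k → 12 * k + 10 ≡ 6 * (k + k) + 10
        arith₁ = solve-∀
        arith₂ : ∀ k → 6 * k + 4 ≡ 3 * (k + k) + 4
        arith₂ = solve-∀
... | k , inj₂ refl = subst₂ CoveringFactor (arith₁ k) (arith₂ k) (coveringFactor-12[k+1]+4 k)
  where arith₁ : ∀ k → 12 * suc k + 4 ≡ 6 * suc (k + k) + 10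
        arith₁ = solve-∀
        arith₂ : ∀ k → 6 * suc k + 1 ≡ 3 * suc (k + k) + 4
        arith₂ = solve-∀

lemma3p6 : (m : ℕ) →
    Σ (AlmostFiveStarFactor (30 * m + 22) 3) λ F →
      ((d : ℕ) → 1 ≤ d → d ≤ 15 * m + 10 →
        Σ Edge λ e → e ∈ edgesOf F × HasForwardDiff (30 * m + 22) d e)
      × ((d : ℕ) → 1 ≤ d → d ≤ 15 * m + 10 →
        countForwardDiff (30 * m + 22) d (edgesOf F) ≤ 2)
      × All (Forward (30 * m + 22)) (edgesOf F)
      × Σ (Edge → Label) λ lab →
          IsPurePrimeLabelling F lab × PrimeStar lab (little F)
lemma3p6 m = subst₂ CoveringFactor (arith₁ m) (arith₂ m) (coveringFactor (5 * m + 2))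
  where
  arith₁ : ∀ m → 6 * (5 * m + 2) + 10 ≡ 30 * m + 22
  arith₁ = solve-∀
  arith₂ : ∀ m → 3 * (5 * m + 2) + 4 ≡ 15 * m + 10
  arith₂ = solve-∀
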